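{- Let $a_{1,1}>a_{1,2}>\cdots>a_{1,n}>0$ and $a_{2,1}>a_{2,2}>\cdots>a_{2,n}>0$ be integers with $a_{1,k}\ge a_{2,k}\ge a_{1,k+1}$ for all $k$ (where $a_{1,n+1}=0$). Consider a single horizontal row of vertices in columns labeled $a_{1,1},\dots,1$ from left to right, in which the vertical edge above column $c$ points up iff $c\in\{a_{1,1},\dots,a_{1,n}\}$ (down otherwise), the vertical edge below column $c$ points up iff $c\in\{a_{2,1},\dots,a_{2,n}\}$ (down otherwise), and the left boundary edge points right. Suppose the horizontal edges are oriented so that every vertex has exactly two incident edges pointing toward it and two pointing away. Then no vertex in this row has type NE if and only if $a_{1,k}-a_{2,k}\le1$ for all $k=1,\dots,n$.
   Context: The type of a vertex is named by its two incident edges pointing toward it; in particular a vertex has type NE if its north (upper) vertical edge points down into it and its east (right) horizontal edge points left into it. This row is the top row (row $0$) of the Sundaram ice model associated with a Gelfand–Tsetlin-type pattern whose first two rows are $(a_{1,1},\dots,a_{1,n},0)$ and $(a_{2,1},\dots,a_{2,n})$. -}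

module Defs where

open import Data.Nat using (ℕ; zero; suc; _+_; _∸_; _<_)
open import Data.Fin using (Fin; toℕ; inject₁) renaming (zero to fzero; suc to fsuc)
open import Data.Bool using (Bool; true; false; not)
open import Data.Product using (_×_; ∃)
open import Relation.Binary.PropositionalEquality using (_≡_)

-- Conventions for one row of the ice model with N = a_{1,1} columns.
-- Positions i : Fin N run left to right; position i carries the column
-- label N ∸ toℕ i (so labels a_{1,1}, …, 1 from left to right).
-- Vertical edges: Bool, true = points up.
-- Horizontal edges: indexed by Fin (suc N); edge j lies immediately to the
-- left of position j (edge 0 = left boundary, edge N = right boundary);
-- Bool, true = points right.

colLabel : (N : ℕ) → Fin N → ℕ
colLabel N i = N ∸ toℕ i

b2n : Bool → ℕ
b2n true  = 1
b2n false = 0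

inDegree : {N : ℕ} → (north south : Fin N → Bool) → (horiz : Fin (suc N) → Bool)
         → Fin N → ℕ
inDegree north south horiz i =
  b2n (not (north i))
  + b2n (south i)
  + b2n (horiz (inject₁ i))
  + b2n (not (horiz (fsuc i)))

IceRule : {N : ℕ} → (north south : Fin N → Bool) → (horiz : Fin (suc N) → Bool) → Set
IceRule north south horiz = ∀ i → inDegree north south horiz i ≡ 2

-- vertex of type NE: north edge points down into it, east edge points left into it
IsNE : {N : ℕ} → (north : Fin N → Bool) → (horiz : Fin (suc N) → Bool) → Fin N → Set
IsNE north horiz i = (north i ≡ false) × (horiz (fsuc i) ≡ false)

StrictlyDecreasing : {n : ℕ} → (Fin n → ℕ) → Set
StrictlyDecreasing {n} a = ∀ (i j : Fin n) → toℕ i < toℕ j → a j < a i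

Positive : {n : ℕ} → (Fin n → ℕ) → Set
Positive a = ∀ i → 0 < a i

InSeq : {n : ℕ} → (Fin n → ℕ) → ℕ → Set
InSeq a c = ∃ λ k → a k ≡ c

-- Write A c and B c for the number of a₁'s and a₂'s exceeding c, and call c
-- the threshold of the horizontal edge between columns c + 1 and c.  The ice
-- rule at a vertex equates the arrows entering it from below or from the west
-- with those leaving it to the north or to the east, so summing along the row
-- from the left boundary gives
--   [edge points right] + A c = 1 + B c.
-- A vertex of type NE in column c + 1 therefore has c + 1 ∉ {a₁ k} and
-- A c = 1 + B c; under interlacing this happens exactly when
-- a₂ k < c + 1 < a₁ k for some k, i.e. when some gap a₁ k − a₂ k is at least 2.
module Submission where

open import Defs
open import Data.Nat using (ℕ; zero; suc; _≤_; _<_; _∸_; _+_; z≤n; s≤s; _<?_; _≤?_)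
open import Data.Nat.Properties
open import Data.Nat.Tactic.RingSolver using (solve-∀)
open import Data.Fin using (Fin; inject₁; toℕ; fromℕ<) renaming (zero to fzero; suc to fsuc)
open import Data.Fin.Properties using (toℕ-inject₁; toℕ-fromℕ<; toℕ-injective; toℕ<n)
open import Data.Fin.Induction using (<-weakInduction)
open import Data.Bool using (Bool; true; false; not)
open import Data.Bool.Properties using (¬-not)
open import Data.Product using (_,_; ∃; proj₁; proj₂)
open import Data.Sum using (inj₁; inj₂)
open import Relation.Nullary using (¬_; does; yes; no; contradiction)
open import Relation.Nullary.Decidable using (does-⇔; dec-true; dec-false)
open import Relation.Unary using (Decidable)
open import Relation.Binary.PropositionalEquality
open import Function using (_∘′_)
open import Function.Bundles using (_⇔_; mk⇔; Equivalence)

open Equivalence using (to; from)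

count : ∀ {n} {P : Fin n → Set} → Decidable P → ℕ
count {zero}  P? = 0
count {suc n} P? = b2n (does (P? fzero)) + count (λ j → P? (fsuc j))

count-cong : ∀ {n} {P Q : Fin n → Set} (P? : Decidable P) (Q? : Decidable Q)
           → (∀ j → P j ⇔ Q j) → count P? ≡ count Q?
count-cong {zero}  P? Q? P⇔Q = refl
count-cong {suc n} P? Q? P⇔Q =
  cong₂ (λ b c → b2n b + c) (does-⇔ (P⇔Q fzero) (P? fzero) (Q? fzero))
                           (count-cong _ _ (λ j → P⇔Q (fsuc j)))

count-initialSegment : ∀ {n} {P : Fin n → Set} (P? : Decidable P) p → p ≤ n
                     → (∀ j → P j ⇔ toℕ j < p) → count P? ≡ p
count-initialSegment {zero}  P? zero    _   _   = refl
count-initialSegment {suc n} P? zero    _   P⇔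
  rewrite dec-false (P? fzero) (n≮0 ∘′ to (P⇔ fzero)) =
  count-initialSegment _ zero z≤n
    (λ j → mk⇔ (λ Pj → contradiction (to (P⇔ (fsuc j)) Pj) n≮0) λ ())
count-initialSegment {suc n} P? (suc p) p≤n P⇔
  rewrite dec-true (P? fzero) (from (P⇔ fzero) (s≤s z≤n)) =
  cong suc (count-initialSegment _ p (≤-pred p≤n)
    (λ j → mk⇔ (λ Pj → ≤-pred (to (P⇔ (fsuc j)) Pj)) (λ j<p → from (P⇔ (fsuc j)) (s≤s j<p))))

false≢true : false ≢ true
false≢true ()

countAbove : ∀ {n} → (Fin n → ℕ) → ℕ → ℕ
countAbove a x = count (λ j → x <? a j)

countAbove-bounded : ∀ {n} (a : Fin n → ℕ) {x} → (∀ j → a j ≤ x) → countAbove a x ≡ 0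
countAbove-bounded a a≤x =
  count-initialSegment _ zero z≤n (λ j → mk⇔ (λ x<aj → contradiction x<aj (≤⇒≯ (a≤x j))) λ ())

module _ {n} {a : Fin n → ℕ} (decr : StrictlyDecreasing a) where

  decreasing-≤ : ∀ i j → toℕ i ≤ toℕ j → a j ≤ a i
  decreasing-≤ i j i≤j with m≤n⇒m<n∨m≡n i≤j
  ... | inj₁ i<j = <⇒≤ (decr i j i<j)
  ... | inj₂ i≡j rewrite toℕ-injective i≡j = ≤-refl

  decreasing-<⇔ : ∀ i j → a j < a i ⇔ toℕ i < toℕ j
  decreasing-<⇔ i j =
    mk⇔ (λ aj<ai → ≰⇒> (λ j≤i → <⇒≱ aj<ai (decreasing-≤ j i j≤i))) (decr i j)

  decreasing-≤⇔ : ∀ i j → a i ≤ a j ⇔ toℕ j ≤ toℕ i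
  decreasing-≤⇔ i j =
    mk⇔ (λ ai≤aj → ≮⇒≥ (λ i<j → <⇒≱ (decr i j i<j) ai≤aj)) (decreasing-≤ j i)

  countAbove-at : ∀ k → countAbove a (a k) ≡ toℕ k
  countAbove-at k = count-initialSegment _ (toℕ k) (<⇒≤ (toℕ<n k)) (λ j → decreasing-<⇔ j k)

  countAbove-justBelow : ∀ k {x} → a k ≡ suc x → countAbove a x ≡ suc (toℕ k)
  countAbove-justBelow k ak≡1+x = count-initialSegment _ (suc (toℕ k)) (toℕ<n k)
    (λ j → let 1+x≤aj⇔j≤k = subst (λ y → y ≤ a j ⇔ toℕ j ≤ toℕ k) ak≡1+x
                                  (decreasing-≤⇔ k j)
           in mk⇔ (s≤s ∘′ to 1+x≤aj⇔j≤k) (from 1+x≤aj⇔j≤k ∘′ ≤-pred))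

  countAbove-pred : ∀ x (b : Bool) → (b ≡ true ⇔ InSeq a (suc x))
                  → countAbove a x ≡ b2n b + countAbove a (suc x)
  countAbove-pred x true b⇔ with to b⇔ refl
  ... | k , ak≡1+x = begin
    countAbove a x               ≡⟨ countAbove-justBelow k ak≡1+x ⟩
    suc (toℕ k)                  ≡⟨ cong suc (sym (countAbove-at k)) ⟩
    suc (countAbove a (a k))     ≡⟨ cong (λ y → suc (countAbove a y)) ak≡1+x ⟩
    suc (countAbove a (suc x))   ∎
    where open ≡-Reasoning
  countAbove-pred x false b⇔ = count-cong _ _ λ j →
    mk⇔ (λ x<aj → ≤∧≢⇒< x<aj (λ 1+x≡aj → false≢true (from b⇔ (j , sym 1+x≡aj))))
        <⇒≤

interlacing-≤ : ∀ {m} {a₁ a₂ : Fin (suc m) → ℕ} → StrictlyDecreasing a₁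
              → (∀ (k : Fin m) → a₁ (fsuc k) ≤ a₂ (inject₁ k))
              → ∀ k j → toℕ k < toℕ j → a₁ j ≤ a₂ k
interlacing-≤ {a₁ = a₁} {a₂} decr₁ interlace k (fsuc j) k<1+j =
  ≤-trans (decreasing-≤ decr₁ (fsuc k′) (fsuc j)
                        (s≤s (≤-trans (≤-reflexive toℕk′≡toℕk) (≤-pred k<1+j))))
          (subst (λ i → a₁ (fsuc k′) ≤ a₂ i) inject₁k′≡k (interlace k′))
  where
  k<m = ≤-<-trans (≤-pred k<1+j) (toℕ<n j)
  k′ = fromℕ< k<m
  toℕk′≡toℕk : toℕ k′ ≡ toℕ k
  toℕk′≡toℕk = toℕ-fromℕ< k<m
  inject₁k′≡k : inject₁ k′ ≡ k
  inject₁k′≡k = toℕ-injective (trans (toℕ-inject₁ k′) toℕk′≡toℕk)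

colLabel-suc : ∀ {N} (i : Fin N) → colLabel N i ≡ suc (N ∸ suc (toℕ i))
colLabel-suc i = +-∸-assoc 1 (toℕ<n i)

colLabel-onto : ∀ {N} c → 0 < c → c ≤ N → ∃ λ (i : Fin N) → colLabel N i ≡ c
colLabel-onto {N} c 0<c c≤N = fromℕ< N∸c<N , (begin
  N ∸ toℕ (fromℕ< N∸c<N) ≡⟨ cong (N ∸_) (toℕ-fromℕ< N∸c<N) ⟩
  N ∸ (N ∸ c)            ≡⟨ m∸[m∸n]≡n c≤N ⟩
  c                      ∎)
  where
  open ≡-Reasoning
  N∸c<N : N ∸ c < N
  N∸c<N = ∸-monoʳ-< 0<c c≤N

iceRule-conservation : ∀ n s w e → b2n (not n) + b2n s + b2n w + b2n (not e) ≡ 2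
                     → b2n s + b2n w ≡ b2n n + b2n e
iceRule-conservation true  true  true  true  _ = refl
iceRule-conservation true  true  false false _ = refl
iceRule-conservation true  false true  false _ = refl
iceRule-conservation false true  false true  _ = refl
iceRule-conservation false false true  true  _ = refl
iceRule-conservation false false false false _ = refl
iceRule-conservation true  true  true  false ()
iceRule-conservation true  true  false true  ()
iceRule-conservation true  false true  true  ()
iceRule-conservation true  false false true  ()
iceRule-conservation true  false false false ()
iceRule-conservation false true  true  true  ()
iceRule-conservation false true  true  false ()
iceRule-conservation false true  false false ()
iceRule-conservation false false true  false ()
iceRule-conservation false false false true  ()

balance-step : ∀ n s w e A B → s + w ≡ n + e → w + A ≡ suc B → e + (n + A) ≡ suc (s + B)
balance-step n s w e A B conserve balance = +-cancelˡ-≡ w _ _ (begin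
  w + (e + (n + A))   ≡⟨ rearrange₁ w e n A ⟩
  (n + e) + (w + A)   ≡⟨ cong₂ _+_ (sym conserve) balance ⟩
  (s + w) + suc B     ≡⟨ rearrange₂ s w B ⟩
  w + suc (s + B)     ∎)
  where
  open ≡-Reasoning
  rearrange₁ : ∀ w e n A → w + (e + (n + A)) ≡ (n + e) + (w + A)
  rearrange₁ = solve-∀
  rearrange₂ : ∀ s w B → (s + w) + suc B ≡ w + suc (s + B)
  rearrange₂ = solve-∀

BalancedAt : ∀ {N m} (a₁ a₂ : Fin m → ℕ) → (Fin (suc N) → Bool) → Fin (suc N) → Set
BalancedAt {N} a₁ a₂ horiz j =
  b2n (horiz j) + countAbove a₁ (N ∸ toℕ j) ≡ suc (countAbove a₂ (N ∸ toℕ j))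

iceRule⇒balanced : ∀ {N m} {a₁ a₂ : Fin m → ℕ}
  {north south : Fin N → Bool} {horiz : Fin (suc N) → Bool}
  → StrictlyDecreasing a₁ → StrictlyDecreasing a₂
  → (∀ k → a₁ k ≤ N) → (∀ k → a₂ k ≤ N)
  → (∀ i → (north i ≡ true) ⇔ InSeq a₁ (colLabel N i))
  → (∀ i → (south i ≡ true) ⇔ InSeq a₂ (colLabel N i))
  → horiz fzero ≡ true → IceRule north south horiz
  → ∀ j → BalancedAt a₁ a₂ horiz j
iceRule⇒balanced {N} {a₁ = a₁} {a₂} {north} {south} {horiz}
                 decr₁ decr₂ a₁≤N a₂≤N north⇔ south⇔ horiz₀ ice =
  <-weakInduction (BalancedAt a₁ a₂ horiz) leftBoundary throughVertex
  where
  leftBoundary : BalancedAt a₁ a₂ horiz fzero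
  leftBoundary rewrite horiz₀ | countAbove-bounded a₁ a₁≤N | countAbove-bounded a₂ a₂≤N = refl

  throughVertex : ∀ i → BalancedAt a₁ a₂ horiz (inject₁ i) → BalancedAt a₁ a₂ horiz (fsuc i)
  throughVertex i west = begin
    e + countAbove a₁ x               ≡⟨ cong (e +_) (countAbove-pred decr₁ x (north i) north⇔′) ⟩
    e + (n + countAbove a₁ (suc x))   ≡⟨ balance-step n s w e _ _ conserve west′ ⟩
    suc (s + countAbove a₂ (suc x))   ≡⟨ cong suc (sym (countAbove-pred decr₂ x (south i) south⇔′)) ⟩
    suc (countAbove a₂ x)             ∎
    where
    open ≡-Reasoning
    x = N ∸ suc (toℕ i)
    n = b2n (north i)
    s = b2n (south i)
    w = b2n (horiz (inject₁ i))
    e = b2n (horiz (fsuc i))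
    conserve : s + w ≡ n + e
    conserve = iceRule-conservation (north i) (south i) (horiz (inject₁ i)) (horiz (fsuc i)) (ice i)
    westLabel : N ∸ toℕ (inject₁ i) ≡ suc x
    westLabel = trans (cong (N ∸_) (toℕ-inject₁ i)) (colLabel-suc i)
    west′ : w + countAbove a₁ (suc x) ≡ suc (countAbove a₂ (suc x))
    west′ = subst (λ y → w + countAbove a₁ y ≡ suc (countAbove a₂ y)) westLabel west
    north⇔′ : (north i ≡ true) ⇔ InSeq a₁ (suc x)
    north⇔′ = subst (λ c → (north i ≡ true) ⇔ InSeq a₁ c) (colLabel-suc i) (north⇔ i)
    south⇔′ : (south i ≡ true) ⇔ InSeq a₂ (suc x)
    south⇔′ = subst (λ c → (south i ≡ true) ⇔ InSeq a₂ c) (colLabel-suc i) (south⇔ i)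

∸≤1⇒≤suc : ∀ {a b} → a ∸ b ≤ 1 → a ≤ suc b
∸≤1⇒≤suc {a} {b} gap =
  ≤-trans (m≤n+m∸n a b) (subst (b + (a ∸ b) ≤_) (+-comm b 1) (+-monoʳ-≤ b gap))

smallGaps⇒noNE : ∀ {N m} {a₁ a₂ : Fin m → ℕ} {north : Fin N → Bool} {horiz : Fin (suc N) → Bool}
  → (∀ k → a₂ k ≤ a₁ k)
  → (∀ i → (north i ≡ true) ⇔ InSeq a₁ (colLabel N i))
  → (∀ j → BalancedAt a₁ a₂ horiz j)
  → (∀ k → a₁ k ∸ a₂ k ≤ 1) → ∀ i → ¬ IsNE north horiz i
smallGaps⇒noNE {N} {a₁ = a₁} {a₂}
               a₂≤a₁ north⇔ balanced gap i (northDown , eastLeft) =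
  1+n≢n (begin
    suc (countAbove a₂ x) ≡⟨ sym unbalanced ⟩
    countAbove a₁ x       ≡⟨ count-cong _ _ (λ j → mk⇔ (a₂-above j) (a₁-above j)) ⟩
    countAbove a₂ x       ∎)
  where
  open ≡-Reasoning
  x = N ∸ suc (toℕ i)
  unbalanced : countAbove a₁ x ≡ suc (countAbove a₂ x)
  unbalanced =
    subst (λ b → b2n b + countAbove a₁ x ≡ suc (countAbove a₂ x)) eastLeft (balanced (fsuc i))
  notInSeq : ∀ j → suc x ≢ a₁ j
  notInSeq j 1+x≡a₁j = false≢true (trans (sym northDown)
    (from (north⇔ i) (j , trans (sym 1+x≡a₁j) (sym (colLabel-suc i)))))
  a₂-above : ∀ j → x < a₁ j → x < a₂ j
  a₂-above j x<a₁j = ≤-pred (≤-trans (≤∧≢⇒< x<a₁j (notInSeq j)) (∸≤1⇒≤suc (gap j)))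
  a₁-above : ∀ j → x < a₂ j → x < a₁ j
  a₁-above j x<a₂j = ≤-trans x<a₂j (a₂≤a₁ j)

wideGap⇒NE : ∀ {N m} {a₁ a₂ : Fin (suc m) → ℕ} {north : Fin N → Bool} {horiz : Fin (suc N) → Bool}
  → StrictlyDecreasing a₁ → StrictlyDecreasing a₂
  → (∀ (k : Fin m) → a₁ (fsuc k) ≤ a₂ (inject₁ k))
  → (∀ k → a₁ k ≤ N)
  → (∀ i → (north i ≡ true) ⇔ InSeq a₁ (colLabel N i))
  → (∀ j → BalancedAt a₁ a₂ horiz j)
  → ∀ k → suc (a₂ k) < a₁ k → ∃ λ i → IsNE north horiz i
wideGap⇒NE {N} {a₁ = a₁} {a₂} {north} {horiz}
           decr₁ decr₂ interlace a₁≤N north⇔ balanced k wide =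
  i , northDown , eastLeft
  where
  open ≡-Reasoning
  y = a₂ k
  column = colLabel-onto (suc y) (s≤s z≤n) (≤-trans (<⇒≤ wide) (a₁≤N k))
  i = proj₁ column
  label : colLabel N i ≡ suc y
  label = proj₂ column
  threshold : N ∸ suc (toℕ i) ≡ y
  threshold = suc-injective (trans (sym (colLabel-suc i)) label)

  notInSeq : ∀ j → a₁ j ≢ suc y
  notInSeq j a₁j≡1+y with toℕ j ≤? toℕ k
  ... | yes j≤k = <-irrefl (sym a₁j≡1+y) (<-≤-trans wide (decreasing-≤ decr₁ j k j≤k))
  ... | no  j≰k = <-irrefl a₁j≡1+y (s≤s (interlacing-≤ decr₁ interlace k j (≰⇒> j≰k)))
  northDown : north i ≡ false
  northDown = ¬-not λ northUp →
    let (j , a₁j≡) = to (north⇔ i) northUp in notInSeq j (trans a₁j≡ label)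

  count₁ : countAbove a₁ y ≡ suc (toℕ k)
  count₁ = count-initialSegment (λ j → y <? a₁ j) (suc (toℕ k)) (toℕ<n k) λ j → mk⇔
    (λ y<a₁j → s≤s (≮⇒≥ (λ k<j → <⇒≱ y<a₁j (interlacing-≤ decr₁ interlace k j k<j))))
    (λ j<1+k → <-≤-trans (<-trans (n<1+n y) wide) (decreasing-≤ decr₁ j k (≤-pred j<1+k)))
  e = b2n (horiz (fsuc i))
  east : e + countAbove a₁ y ≡ suc (countAbove a₂ y)
  east = subst (λ z → e + countAbove a₁ z ≡ suc (countAbove a₂ z)) threshold (balanced (fsuc i))
  eastBalanced : e + suc (toℕ k) ≡ suc (toℕ k)
  eastBalanced = begin
    e + suc (toℕ k)        ≡⟨ cong (e +_) (sym count₁) ⟩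
    e + countAbove a₁ y    ≡⟨ east ⟩
    suc (countAbove a₂ y)  ≡⟨ cong suc (countAbove-at decr₂ k) ⟩
    suc (toℕ k)            ∎
  eastLeft : horiz (fsuc i) ≡ false
  eastLeft = ¬-not λ eastRight →
    1+n≢n (subst (λ b → b2n b + suc (toℕ k) ≡ suc (toℕ k)) eastRight eastBalanced)

mainTheorem4 : (m : ℕ) (a₁ a₂ : Fin (suc m) → ℕ)
    → StrictlyDecreasing a₁ → StrictlyDecreasing a₂
    → Positive a₁ → Positive a₂
    → (∀ k → a₂ k ≤ a₁ k)
    → (∀ (k : Fin m) → a₁ (fsuc k) ≤ a₂ (inject₁ k))
    → (north south : Fin (a₁ fzero) → Bool)
    → (horiz : Fin (suc (a₁ fzero)) → Bool)
    → (∀ i → (north i ≡ true) ⇔ InSeq a₁ (colLabel (a₁ fzero) i))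
    → (∀ i → (south i ≡ true) ⇔ InSeq a₂ (colLabel (a₁ fzero) i))
    → horiz fzero ≡ true
    → IceRule north south horiz
    → (∀ i → ¬ IsNE north horiz i) ⇔ (∀ k → a₁ k ∸ a₂ k ≤ 1)
-- Positivity of the entries is not needed.
mainTheorem4 m a₁ a₂ decr₁ decr₂ _ _ a₂≤a₁ interlace north south horiz
             north⇔ south⇔ horiz₀ ice =
  mk⇔ noNE⇒smallGaps (smallGaps⇒noNE {horiz = horiz} a₂≤a₁ north⇔ balanced)
  where
  a₁≤N : ∀ k → a₁ k ≤ a₁ fzero
  a₁≤N k = decreasing-≤ decr₁ fzero k z≤n
  balanced : ∀ j → BalancedAt a₁ a₂ horiz j
  balanced = iceRule⇒balanced {horiz = horiz} decr₁ decr₂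
               a₁≤N (λ k → ≤-trans (a₂≤a₁ k) (a₁≤N k)) north⇔ south⇔ horiz₀ ice
  noNE⇒smallGaps : (∀ i → ¬ IsNE north horiz i) → ∀ k → a₁ k ∸ a₂ k ≤ 1
  noNE⇒smallGaps noNE k with a₁ k ≤? suc (a₂ k)
  ... | yes narrow = m≤n+o⇒m∸n≤o (a₁ k) (a₂ k) (subst (a₁ k ≤_) (+-comm 1 (a₂ k)) narrow)
  ... | no  wide   =
    let (i , ne) = wideGap⇒NE {horiz = horiz} decr₁ decr₂ interlace a₁≤N north⇔ balanced k (≰⇒> wide)
    in contradiction ne (noNE i)
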